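{- Let $G$ be a graph on $n$ vertices and let $k$ be an integer with $2 \le k \le n-2$. Then the $k$-token graph $F_k(G)$ is regular if and only if one of the following holds: (1) $G$ is isomorphic to the complete graph $K_n$; (2) $G$ is isomorphic to the edgeless graph $\overline{K_n}$; (3) $G$ is isomorphic to the star $K_{1,n-1}$ and $k=n/2$; (4) $G$ is isomorphic to the complement $\overline{K_{1,n-1}}$ of the star and $k=n/2$.
   Context: All graphs are finite and simple. For a graph $G=(V,E)$ on $n$ vertices and an integer $1\le k<n$, the $k$-token graph $F_k(G)$ is the graph whose vertices are all $k$-element subsets of $V$, two such subsets $A,B$ being adjacent whenever their symmetric difference $A\triangle B$ is a pair $\{a,b\}$ with $a$ adjacent to $b$ in $G$. $\overline{H}$ denotes the complement of a graph $H$. -}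

module Defs where

open import Data.Nat using (ℕ; zero; suc)
open import Data.Bool using (Bool; true; false; _∧_; _∨_; not; T)
open import Data.Fin using (Fin; zero; suc)
open import Data.Fin.Properties using (_≟_)
open import Data.Fin.Subset using (Subset; ⁅_⁆; _∪_; ∣_∣; _∈_)
open import Data.Vec using (Vec; []; _∷_; zipWith)
open import Data.List using (List; []; _∷_; map; _++_; length; filterᵇ)
open import Data.Product using (Σ; ∃; ∃-syntax; _×_; _,_)
open import Relation.Nullary.Decidable using (⌊_⌋)
open import Relation.Binary.PropositionalEquality using (_≡_; refl; cong; cong₂) renaming (sym to ≡-sym)
open import Relation.Nullary using (yes; no)
open import Data.Empty using (⊥-elim)
open import Data.Bool using (_xor_) renaming (_≟_ to _≟ᵇ_)
open import Data.Nat using () renaming (_≟_ to _≟ⁿ_)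
open import Data.List using (allFin)
open import Function.Bundles using (_↔_; Inverse)

record Graph (n : ℕ) : Set where
  field
    adj   : Fin n → Fin n → Bool
    sym   : ∀ i j → adj i j ≡ adj j i
    irefl : ∀ i → adj i i ≡ false
open Graph public

-- Graph isomorphism: a bijection of the vertex sets preserving adjacency
-- (in both directions, since adjacency is Bool-valued).
_≅_ : ∀ {n} → Graph n → Graph n → Set
_≅_ {n} G H = Σ (Fin n ↔ Fin n) λ σ →
  ∀ i j → adj G (Inverse.to σ i) (Inverse.to σ j) ≡ adj H i j

_==_ : ∀ {n} → Fin n → Fin n → Bool
i == j = ⌊ i ≟ j ⌋

complete : ∀ n → Graph n
complete n = record { adj = λ i j → not (i == j) ; sym = s ; irefl = r }
  where
  s : ∀ (i j : Fin n) → not (i == j) ≡ not (j == i)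
  s i j with i ≟ j | j ≟ i
  ... | yes _ | yes _ = refl
  ... | no _  | no _  = refl
  ... | yes p | no q  = ⊥-elim (q (≡-sym p))
  ... | no q  | yes p = ⊥-elim (q (≡-sym p))
  r : ∀ (i : Fin n) → not (i == i) ≡ false
  r i with i ≟ i
  ... | yes _ = refl
  ... | no q  = ⊥-elim (q refl)

complement : ∀ {n} → Graph n → Graph n
complement {n} G = record
  { adj = λ i j → not (i == j) ∧ not (adj G i j)
  ; sym = s ; irefl = r }
  where
  s : ∀ i j → (not (i == j) ∧ not (adj G i j)) ≡ (not (j == i) ∧ not (adj G j i))
  s i j = cong₂ _∧_ (Graph.sym (complete n) i j) (cong not (Graph.sym G i j))
  r : ∀ i → (not (i == i) ∧ not (adj G i i)) ≡ false
  r i rewrite Graph.irefl (complete n) i = refl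

edgeless : ∀ n → Graph n
edgeless n = complement (complete n)

star : ∀ m → Graph (suc m)
star m = record { adj = a ; sym = s ; irefl = r }
  where
  a : Fin (suc m) → Fin (suc m) → Bool
  a zero zero = false
  a zero (suc _) = true
  a (suc _) zero = true
  a (suc _) (suc _) = false
  s : ∀ i j → a i j ≡ a j i
  s zero zero = refl
  s zero (suc _) = refl
  s (suc _) zero = refl
  s (suc _) (suc _) = refl
  r : ∀ i → a i i ≡ false
  r zero = refl
  r (suc _) = refl

_==ˢ_ : ∀ {n} → Subset n → Subset n → Bool
[] ==ˢ [] = true
(x ∷ xs) ==ˢ (y ∷ ys) = ⌊ x ≟ᵇ y ⌋ ∧ (xs ==ˢ ys)

_△_ : ∀ {n} → Subset n → Subset n → Subset n
A △ B = zipWith _xor_ A B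

allVertices : ∀ n → List (Fin n)
allVertices n = allFin n

allSubsets : ∀ n → List (Subset n)
allSubsets zero = [] ∷ []
allSubsets (suc n) = map (false ∷_) (allSubsets n) ++ map (true ∷_) (allSubsets n)

anyL : ∀ {A : Set} → (A → Bool) → List A → Bool
anyL p [] = false
anyL p (x ∷ xs) = p x ∨ anyL p xs

tokenAdj : ∀ {n} → Graph n → Subset n → Subset n → Bool
tokenAdj {n} G A B =
  anyL (λ a → anyL (λ b → adj G a b ∧ ((A △ B) ==ˢ (⁅ a ⁆ ∪ ⁅ b ⁆))) (allVertices n)) (allVertices n)

tokenDegree : ∀ {n} → Graph n → ℕ → Subset n → ℕ
tokenDegree {n} G k A =
  length (filterᵇ (λ B → ⌊ ∣ B ∣ ≟ⁿ k ⌋ ∧ tokenAdj G A B) (allSubsets n))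

-- star K_{1,n-1} on n vertices (for n = 0 it is the empty graph, which is
-- irrelevant for the theorem since there n ≥ 4)
starGraph : ∀ n → Graph n
starGraph zero = edgeless zero
starGraph (suc m) = star m

TokenRegular : ∀ {n} → Graph n → ℕ → Set
TokenRegular {n} G k = ∃[ d ] ∀ (A : Subset n) → ∣ A ∣ ≡ k → tokenDegree G k A ≡ d

-- The degree of a k-set A in F_k(G) is the number of edges of G leaving A.  Adding two vertices
-- p, q outside a (k-2)-set T to T shows that if F_k(G) is regular, then for all p ≠ q outside T
-- the indicator [pq] equals f(p) + f(q) + const for some f depending on T.  As n ≥ k + 2, such a T
-- can avoid any four vertices, so [pr] + [qs] = [ps] + [qr] whenever the four pairs are proper.
-- This four-point condition leaves only complete and edgeless graphs, stars and co-stars.  In a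
-- star the number of edges leaving a k-set is n - k or k according as it contains the centre, in
-- a co-star it is k(n - k) minus that, so either is constant exactly when 2k = n.

module Submission where

open import Defs hiding (sym)
open import Data.Nat using (ℕ; zero; suc; _+_; _*_; _∸_; _≤_; z≤n; s≤s; s≤s⁻¹) renaming (_≟_ to _≟ⁿ_)
open import Data.Nat.Properties hiding (_≟_)
open import Data.Nat.ListAction using () renaming (sum to sumˡ)
open import Data.Nat.ListAction.Properties using (sum-++)
open import Data.Nat.Tactic.RingSolver using (solve-∀)
open import Data.Bool using (Bool; true; false; not; _∧_; _∨_; _xor_)
open import Data.Bool.Properties using (∨-identityʳ; ∨-zeroʳ; ∧-zeroʳ; ∨-comm; xor-identityʳ) renaming (_≟_ to _≟ᵇ_)
open import Data.Bool.ListAction using (any)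
open import Data.Fin using (Fin; zero; suc)
open import Data.Fin.Properties using (_≟_; any?)
open import Data.Fin.Subset using (Subset; ⁅_⁆; _∪_; ∣_∣)
open import Data.Fin.Permutation using (transpose)
open import Data.List using (List; []; _∷_; map; _++_; length; filterᵇ)
open import Data.List.Properties using (map-++; map-∘; map-cong)
open import Data.List.Membership.Propositional using (_∈_)
open import Data.List.Membership.Propositional.Properties using (∈-allFin)
open import Data.List.Relation.Unary.Any using (here; there)
open import Data.Product using (∃; ∃₂; ∃-syntax; _×_; _,_; proj₁; proj₂)
open import Data.Sum using (_⊎_; inj₁; inj₂)
open import Data.Vec using ([]; _∷_; lookup; tabulate)
open import Data.Vec.Properties using (lookup-zipWith; lookup-replicate; lookup∘tabulate)
open import Function using (_∘_)
open import Function.Bundles using (_↔_; _⇔_; mk⇔; Inverse; Equivalence)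
open import Function.Construct.Identity using (↔-id)
open import Relation.Binary.PropositionalEquality
open import Relation.Nullary using (Dec; ¬_; yes; no; contradiction)
open import Relation.Nullary.Decidable using (⌊_⌋; _×-dec_; ¬?)
open import Algebra.Properties.Semiring.Sum +-*-semiring
  using (sum-syntax; sum-cong-≗; sum-replicate-zero; ∑-distrib-+; *-distribˡ-sum; *-distribʳ-sum)

⌊⌋-true : ∀ {P : Set} (P? : Dec P) → P → ⌊ P? ⌋ ≡ true
⌊⌋-true (yes _) _ = refl
⌊⌋-true (no ¬p) p = contradiction p ¬p

⌊⌋-false : ∀ {P : Set} (P? : Dec P) → ¬ P → ⌊ P? ⌋ ≡ false
⌊⌋-false (yes p) ¬p = contradiction p ¬p
⌊⌋-false (no _)  _  = refl

⌊⌋-sound : ∀ {P : Set} (P? : Dec P) → ⌊ P? ⌋ ≡ true → P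
⌊⌋-sound (yes p) _ = p

∧-true : ∀ {a b} → a ∧ b ≡ true → a ≡ true × b ≡ true
∧-true {true} {true} _ = refl , refl

==-refl : ∀ {n} (x : Fin n) → (x == x) ≡ true
==-refl x = ⌊⌋-true (x ≟ x) refl

==-≢ : ∀ {n} {x y : Fin n} → x ≢ y → (x == y) ≡ false
==-≢ {x = x} {y} = ⌊⌋-false (x ≟ y)

-- Indicator sums

ind : Bool → ℕ
ind true  = 1
ind false = 0

ind-not : ∀ b → ind (not b) + ind b ≡ 1
ind-not true  = refl
ind-not false = refl

size : ∀ {n} → (Fin n → Bool) → ℕ
size {n} α = ∑[ x < n ] ind (α x)

∑-δ : ∀ {n} (f : Fin n → ℕ) (p : Fin n) → ∑[ x < n ] (ind (x == p) * f x) ≡ f p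
∑-δ {suc n} f zero = trans (cong₂ _+_ (+-identityʳ (f zero)) (sum-replicate-zero n)) (+-identityʳ (f zero))
∑-δ {suc n} f (suc p) = trans (sum-cong-≗ {n} λ x → cong (λ b → ind b * f (suc x)) (suc-== x p)) (∑-δ (f ∘ suc) p)
  where
  suc-== : ∀ {n} (x y : Fin n) → (suc x == suc y) ≡ (x == y)
  suc-== x y with x ≟ y
  ... | yes _ = refl
  ... | no _  = refl

size-δ : ∀ {n} (p : Fin n) → size (λ x → x == p) ≡ 1
size-δ {n} p = trans (sum-cong-≗ {n} λ x → sym (*-identityʳ (ind (x == p)))) (∑-δ (λ _ → 1) p)

size-compl : ∀ {n} (α : Fin n → Bool) → size (not ∘ α) + size α ≡ n
size-compl {n} α = trans (sym (∑-distrib-+ (ind ∘ not ∘ α) (ind ∘ α))) (trans (sum-cong-≗ (ind-not ∘ α)) (∑-one n))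
  where
  ∑-one : ∀ n → ∑[ x < n ] 1 ≡ n
  ∑-one zero    = refl
  ∑-one (suc n) = cong suc (∑-one n)

insert : ∀ {n} → (Fin n → Bool) → Fin n → Fin n → Bool
insert α p x = α x ∨ (x == p)

insert-here : ∀ {n} (α : Fin n → Bool) p → insert α p p ≡ true
insert-here α p rewrite ==-refl p = ∨-zeroʳ (α p)

insert-≢ : ∀ {n} (α : Fin n → Bool) {p x} → x ≢ p → insert α p x ≡ α x
insert-≢ α {x = x} x≢p rewrite ==-≢ x≢p = ∨-identityʳ (α x)

module _ {n} (α : Fin n → Bool) (p : Fin n) (p∉α : α p ≡ false) where

  ind-insert : ∀ x → ind (insert α p x) ≡ ind (α x) + ind (x == p)
  ind-insert x with x ≟ p
  ... | yes refl rewrite p∉α = refl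
  ... | no _ = trans (cong ind (∨-identityʳ (α x))) (sym (+-identityʳ _))

  ∑-insert : (f : Fin n → ℕ) → ∑[ x < n ] (ind (insert α p x) * f x) ≡ ∑[ x < n ] (ind (α x) * f x) + f p
  ∑-insert f = begin
    ∑[ x < n ] (ind (insert α p x) * f x)
      ≡⟨ sum-cong-≗ {n} (λ x → trans (cong (_* f x) (ind-insert x)) (*-distribʳ-+ (f x) (ind (α x)) _)) ⟩
    ∑[ x < n ] (ind (α x) * f x + ind (x == p) * f x)
      ≡⟨ ∑-distrib-+ {n} _ _ ⟩
    ∑[ x < n ] (ind (α x) * f x) + ∑[ x < n ] (ind (x == p) * f x)
      ≡⟨ cong (_ +_) (∑-δ f p) ⟩
    ∑[ x < n ] (ind (α x) * f x) + f p ∎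
    where open ≡-Reasoning

  size-insert : size (insert α p) ≡ suc (size α)
  size-insert = begin
    size (insert α p)                     ≡⟨ sum-cong-≗ {n} ind-insert ⟩
    ∑[ x < n ] (ind (α x) + ind (x == p)) ≡⟨ ∑-distrib-+ {n} _ _ ⟩
    size α + size (λ x → x == p)          ≡⟨ cong (size α +_) (size-δ p) ⟩
    size α + 1                            ≡⟨ +-comm (size α) 1 ⟩
    suc (size α)                          ∎
    where open ≡-Reasoning

-- Weighted cuts

Weight : ℕ → Set
Weight n = Fin n → Fin n → ℕ

degreeIn : ∀ {n} → Weight n → (Fin n → Bool) → Fin n → ℕ
degreeIn {n} w β x = ∑[ y < n ] (ind (β y) * w x y)

degree : ∀ {n} → Weight n → Fin n → ℕ
degree w = degreeIn w (λ _ → true)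

between : ∀ {n} → Weight n → (Fin n → Bool) → (Fin n → Bool) → ℕ
between {n} w α β = ∑[ x < n ] (ind (α x) * degreeIn w β x)

cut : ∀ {n} → Weight n → (Fin n → Bool) → ℕ
cut w α = between w α (not ∘ α)

cut+between-self : ∀ {n} (w : Weight n) α → cut w α + between w α α ≡ ∑[ x < n ] (ind (α x) * degree w x)
cut+between-self {n} w α = trans (sym (∑-distrib-+ {n} _ _)) (sum-cong-≗ {n} λ x →
  trans (sym (*-distribˡ-+ (ind (α x)) _ _)) (cong (ind (α x) *_) (degreeIn-compl x)))
  where
  degreeIn-compl : ∀ x → degreeIn w (not ∘ α) x + degreeIn w α x ≡ degree w x
  degreeIn-compl x = trans (sym (∑-distrib-+ {n} _ _)) (sum-cong-≗ {n} λ y →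
    trans (sym (*-distribʳ-+ (w x y) (ind (not (α y))) (ind (α y)))) (cong (_* w x y) (ind-not (α y))))

module _ {n} (w : Weight n) (w-sym : ∀ x y → w x y ≡ w y x) (w-irrefl : ∀ x → w x x ≡ 0)
         (α : Fin n → Bool) (p : Fin n) (p∉α : α p ≡ false) where

  between-insert-self : between w (insert α p) (insert α p) ≡ between w α α + 2 * degreeIn w α p
  between-insert-self = begin
    between w α′ α′                        ≡⟨ ∑-insert α p p∉α (degreeIn w α′) ⟩
    between w α α′ + degreeIn w α′ p        ≡⟨ cong₂ _+_ column (∑-insert α p p∉α (w p)) ⟩
    (b + e) + (e + w p p)                  ≡⟨ cong (λ t → (b + e) + (e + t)) (w-irrefl p) ⟩
    (b + e) + (e + 0)                      ≡⟨ arith b e ⟩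
    b + 2 * e                              ∎
    where
    open ≡-Reasoning
    α′ = insert α p
    b = between w α α
    e = degreeIn w α p
    arith : ∀ b e → (b + e) + (e + 0) ≡ b + 2 * e
    arith = solve-∀
    column : between w α α′ ≡ b + e
    column = begin
      ∑[ x < n ] (ind (α x) * degreeIn w α′ x)
        ≡⟨ sum-cong-≗ {n} (λ x → cong (ind (α x) *_) (∑-insert α p p∉α (w x))) ⟩
      ∑[ x < n ] (ind (α x) * (degreeIn w α x + w x p))
        ≡⟨ sum-cong-≗ {n} (λ x → *-distribˡ-+ (ind (α x)) _ _) ⟩
      ∑[ x < n ] (ind (α x) * degreeIn w α x + ind (α x) * w x p)
        ≡⟨ ∑-distrib-+ {n} _ _ ⟩
      b + ∑[ x < n ] (ind (α x) * w x p)
        ≡⟨ cong (b +_) (sum-cong-≗ {n} λ x → cong (ind (α x) *_) (w-sym x p)) ⟩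
      b + e ∎

  -- cut w α + between w α α is the total degree of α; inserting p adds degree w p to it
  -- and 2 · degreeIn w α p to the inner term.
  cut-insert : cut w (insert α p) + 2 * degreeIn w α p ≡ cut w α + degree w p
  cut-insert = +-cancelʳ-≡ b _ _ (begin
    cut w α′ + 2 * e + b                              ≡⟨ arith (cut w α′) (2 * e) b ⟩
    cut w α′ + (b + 2 * e)                            ≡⟨ cong (cut w α′ +_) (sym between-insert-self) ⟩
    cut w α′ + between w α′ α′                        ≡⟨ cut+between-self w α′ ⟩
    ∑[ x < n ] (ind (α′ x) * degree w x)              ≡⟨ ∑-insert α p p∉α (degree w) ⟩
    ∑[ x < n ] (ind (α x) * degree w x) + degree w p  ≡⟨ cong (_+ degree w p) (sym (cut+between-self w α)) ⟩
    cut w α + b + degree w p                          ≡⟨ swap (cut w α) b (degree w p) ⟩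
    cut w α + degree w p + b                          ∎)
    where
    open ≡-Reasoning
    α′ = insert α p
    b = between w α α
    e = degreeIn w α p
    arith : ∀ a b c → a + b + c ≡ a + (c + b)
    arith = solve-∀
    swap : ∀ a b c → a + b + c ≡ a + c + b
    swap = solve-∀

cut-cong-crossing : ∀ {n} {w w′ : Weight n} (α : Fin n → Bool) →
  (∀ x y → α x ≡ true → α y ≡ false → w x y ≡ w′ x y) → cut w α ≡ cut w′ α
cut-cong-crossing {n} {w} {w′} α w≡w′ = sum-cong-≗ {n} row
  where
  row : ∀ x → ind (α x) * degreeIn w (not ∘ α) x ≡ ind (α x) * degreeIn w′ (not ∘ α) x
  row x with α x in αx
  ... | false = refl
  ... | true  = cong (_+ 0) (sum-cong-≗ {n} entry)
    where
    entry : ∀ y → ind (not (α y)) * w x y ≡ ind (not (α y)) * w′ x y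
    entry y with α y in αy
    ... | true  = refl
    ... | false = cong (_+ 0) (w≡w′ x y αx αy)

cut-cong-weight : ∀ {n} {w w′ : Weight n} (α : Fin n → Bool) → (∀ x y → w x y ≡ w′ x y) → cut w α ≡ cut w′ α
cut-cong-weight α w≗w′ = cut-cong-crossing α (λ x y _ _ → w≗w′ x y)

cut-cong-set : ∀ {n} (w : Weight n) {α β : Fin n → Bool} → (∀ x → α x ≡ β x) → cut w α ≡ cut w β
cut-cong-set {n} w α≗β = sum-cong-≗ {n} λ x →
  cong₂ _*_ (cong ind (α≗β x)) (sum-cong-≗ {n} λ y → cong (λ b → ind (not b) * w x y) (α≗β y))

cut-zero : ∀ {n} (α : Fin n → Bool) → cut (λ _ _ → 0) α ≡ 0
cut-zero {n} α = trans (sum-cong-≗ {n} row-zero) (sum-replicate-zero n)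
  where
  row-zero : ∀ x → ind (α x) * ∑[ y < n ] (ind (not (α y)) * 0) ≡ 0
  row-zero x = trans (cong (ind (α x) *_) (trans (sum-cong-≗ {n} λ y → *-zeroʳ (ind (not (α y)))) (sum-replicate-zero n)))
                     (*-zeroʳ (ind (α x)))

cut-+ : ∀ {n} (w w′ : Weight n) α → cut w α + cut w′ α ≡ cut (λ x y → w x y + w′ x y) α
cut-+ {n} w w′ α = trans (sym (∑-distrib-+ {n} _ _)) (sum-cong-≗ {n} row)
  where
  row : ∀ x → ind (α x) * degreeIn w (not ∘ α) x + ind (α x) * degreeIn w′ (not ∘ α) x
            ≡ ind (α x) * degreeIn (λ x y → w x y + w′ x y) (not ∘ α) x
  row x = trans (sym (*-distribˡ-+ (ind (α x)) _ _)) (cong (ind (α x) *_) (trans (sym (∑-distrib-+ {n} _ _))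
            (sum-cong-≗ {n} λ y → sym (*-distribˡ-+ (ind (not (α y))) (w x y) (w′ x y)))))

cut-product : ∀ {n} (f g : Fin n → ℕ) α →
  cut (λ x y → f x * g y) α ≡ ∑[ x < n ] (ind (α x) * f x) * ∑[ y < n ] (ind (not (α y)) * g y)
cut-product {n} f g α = begin
  ∑[ x < n ] (ind (α x) * ∑[ y < n ] (ind (not (α y)) * (f x * g y)))
    ≡⟨ sum-cong-≗ {n} (λ x → cong (ind (α x) *_) (trans (sum-cong-≗ {n} λ y → rotate (ind (not (α y))) (f x) (g y))
                                                         (sym (*-distribˡ-sum {n} (f x) _)))) ⟩
  ∑[ x < n ] (ind (α x) * (f x * G))   ≡⟨ sum-cong-≗ {n} (λ x → sym (*-assoc (ind (α x)) (f x) G)) ⟩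
  ∑[ x < n ] (ind (α x) * f x * G)     ≡⟨ sym (*-distribʳ-sum {n} G _) ⟩
  ∑[ x < n ] (ind (α x) * f x) * G     ∎
  where
  open ≡-Reasoning
  G = ∑[ y < n ] (ind (not (α y)) * g y)
  rotate : ∀ a b c → a * (b * c) ≡ b * (a * c)
  rotate = solve-∀

weightOf : ∀ {n} → (Fin n → Fin n → Bool) → Weight n
weightOf a x y = ind (a x y)

≢-crossing : ∀ {n} (α : Fin n → Bool) {x y} → α x ≡ true → α y ≡ false → x ≢ y
≢-crossing α αx αy refl = contradiction (trans (sym αx) αy) λ ()

∑-ind-δ : ∀ {n} (α : Fin n → Bool) c → ∑[ x < n ] (ind (α x) * ind (x == c)) ≡ ind (α c)
∑-ind-δ {n} α c = trans (sum-cong-≗ {n} λ x → *-comm (ind (α x)) _) (∑-δ (ind ∘ α) c)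

size-*1 : ∀ {n} (α : Fin n → Bool) → ∑[ x < n ] (ind (α x) * 1) ≡ size α
size-*1 {n} α = sum-cong-≗ {n} (*-identityʳ ∘ ind ∘ α)

cut-complete : ∀ {n} (α : Fin n → Bool) → cut (weightOf λ x y → not (x == y)) α ≡ size α * size (not ∘ α)
cut-complete α = begin
  cut (weightOf λ x y → not (x == y)) α
    ≡⟨ cut-cong-crossing α (λ x y αx αy → cong (ind ∘ not) (==-≢ (≢-crossing α αx αy))) ⟩
  cut (λ x y → 1 * 1) α
    ≡⟨ cut-product (λ _ → 1) (λ _ → 1) α ⟩
  ∑[ x < _ ] (ind (α x) * 1) * ∑[ y < _ ] (ind (not (α y)) * 1)
    ≡⟨ cong₂ _*_ (size-*1 α) (size-*1 (not ∘ α)) ⟩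
  size α * size (not ∘ α) ∎
  where open ≡-Reasoning

cut-complement : ∀ {n} (a : Fin n → Fin n → Bool) α →
  cut (weightOf λ x y → not (x == y) ∧ not (a x y)) α + cut (weightOf a) α ≡ size α * size (not ∘ α)
cut-complement a α = trans (cut-+ _ _ α) (trans (cut-cong-crossing α split) (cut-complete α))
  where
  split : ∀ x y → α x ≡ true → α y ≡ false → ind (not (x == y) ∧ not (a x y)) + ind (a x y) ≡ ind (not (x == y))
  split x y αx αy rewrite ==-≢ (≢-crossing α αx αy) = ind-not (a x y)

starAdj : ∀ {n} → Fin n → Fin n → Fin n → Bool
starAdj c x y = (x == c) xor (y == c)

cut-star-∈ : ∀ {n} c (α : Fin n → Bool) → α c ≡ true → cut (weightOf (starAdj c)) α ≡ size (not ∘ α)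
cut-star-∈ c α αc = begin
  cut (weightOf (starAdj c)) α
    ≡⟨ cut-cong-crossing α centre-in ⟩
  cut (λ x y → ind (x == c) * 1) α
    ≡⟨ cut-product (λ x → ind (x == c)) (λ _ → 1) α ⟩
  ∑[ x < _ ] (ind (α x) * ind (x == c)) * ∑[ y < _ ] (ind (not (α y)) * 1)
    ≡⟨ cong₂ _*_ (trans (∑-ind-δ α c) (cong ind αc)) (size-*1 (not ∘ α)) ⟩
  1 * size (not ∘ α)
    ≡⟨ *-identityˡ _ ⟩
  size (not ∘ α) ∎
  where
  open ≡-Reasoning
  centre-in : ∀ x y → α x ≡ true → α y ≡ false → ind (starAdj c x y) ≡ ind (x == c) * 1
  centre-in x y _ αy rewrite ==-≢ (≢-crossing α αc αy ∘ sym) =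
    trans (cong ind (xor-identityʳ (x == c))) (sym (*-identityʳ _))

cut-star-∉ : ∀ {n} c (α : Fin n → Bool) → α c ≡ false → cut (weightOf (starAdj c)) α ≡ size α
cut-star-∉ c α αc = begin
  cut (weightOf (starAdj c)) α
    ≡⟨ cut-cong-crossing α centre-out ⟩
  cut (λ x y → 1 * ind (y == c)) α
    ≡⟨ cut-product (λ _ → 1) (λ y → ind (y == c)) α ⟩
  ∑[ x < _ ] (ind (α x) * 1) * ∑[ y < _ ] (ind (not (α y)) * ind (y == c))
    ≡⟨ cong₂ _*_ (size-*1 α) (trans (∑-ind-δ (not ∘ α) c) (cong (ind ∘ not) αc)) ⟩
  size α * 1
    ≡⟨ *-identityʳ _ ⟩
  size α ∎
  where
  open ≡-Reasoning
  centre-out : ∀ x y → α x ≡ true → α y ≡ false → ind (starAdj c x y) ≡ 1 * ind (y == c)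
  centre-out x y αx _ rewrite ==-≢ (≢-crossing α αx αc) = sym (+-identityʳ _)

-- Flipping two points

size-xor : ∀ {n} (α β : Fin n → Bool) →
  size (λ z → α z xor β z) + 2 * size (λ z → α z ∧ β z) ≡ size α + size β
size-xor {n} α β = begin
  size (λ z → α z xor β z) + 2 * size (λ z → α z ∧ β z)
    ≡⟨ cong (size (λ z → α z xor β z) +_) (*-distribˡ-sum {n} 2 _) ⟩
  size (λ z → α z xor β z) + ∑[ z < n ] (2 * ind (α z ∧ β z))
    ≡⟨ sym (∑-distrib-+ {n} _ _) ⟩
  ∑[ z < n ] (ind (α z xor β z) + 2 * ind (α z ∧ β z))
    ≡⟨ sum-cong-≗ {n} (λ z → pointwise (α z) (β z)) ⟩
  ∑[ z < n ] (ind (α z) + ind (β z))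
    ≡⟨ ∑-distrib-+ {n} _ _ ⟩
  size α + size β ∎
  where
  open ≡-Reasoning
  pointwise : ∀ a b → ind (a xor b) + 2 * ind (a ∧ b) ≡ ind a + ind b
  pointwise true  true  = refl
  pointwise true  false = refl
  pointwise false true  = refl
  pointwise false false = refl

pairSet : ∀ {n} → Fin n → Fin n → Fin n → Bool
pairSet x y z = (z == x) ∨ (z == y)

size-∧-pairSet : ∀ {n} (α : Fin n → Bool) {x y} → x ≢ y →
  size (λ z → α z ∧ pairSet x y z) ≡ ind (α x) + ind (α y)
size-∧-pairSet {n} α {x} {y} x≢y = begin
  size (λ z → α z ∧ pairSet x y z)
    ≡⟨ sum-cong-≗ {n} split ⟩
  ∑[ z < n ] (ind (α z) * ind (z == x) + ind (α z) * ind (z == y))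
    ≡⟨ ∑-distrib-+ {n} _ _ ⟩
  ∑[ z < n ] (ind (α z) * ind (z == x)) + ∑[ z < n ] (ind (α z) * ind (z == y))
    ≡⟨ cong₂ _+_ (∑-ind-δ α x) (∑-ind-δ α y) ⟩
  ind (α x) + ind (α y) ∎
  where
  open ≡-Reasoning
  split : ∀ z → ind (α z ∧ pairSet x y z) ≡ ind (α z) * ind (z == x) + ind (α z) * ind (z == y)
  split z with z ≟ x | z ≟ y | α z
  ... | yes refl | yes refl | _     = contradiction refl x≢y
  ... | yes _    | no _     | true  = refl
  ... | yes _    | no _     | false = refl
  ... | no _     | yes _    | true  = refl
  ... | no _     | yes _    | false = refl
  ... | no _     | no _     | true  = refl
  ... | no _     | no _     | false = refl

size-flip : ∀ {n} (α β : Fin n → Bool) {x y} → x ≢ y → (∀ z → β z ≡ α z xor pairSet x y z) →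
  size β + 2 * (ind (α x) + ind (α y)) ≡ size α + 2
size-flip {n} α β {x} {y} x≢y β≗ = begin
  size β + 2 * (ind (α x) + ind (α y))
    ≡⟨ cong₂ (λ s t → s + 2 * t) (sum-cong-≗ {n} (cong ind ∘ β≗)) (sym (size-∧-pairSet α x≢y)) ⟩
  size (λ z → α z xor pairSet x y z) + 2 * size (λ z → α z ∧ pairSet x y z)
    ≡⟨ size-xor α (pairSet x y) ⟩
  size α + size (pairSet x y)
    ≡⟨ cong (size α +_) (size-∧-pairSet (λ _ → true) x≢y) ⟩
  size α + 2 ∎
  where open ≡-Reasoning

size-flip-crossing : ∀ {n} (α β : Fin n → Bool) {x y} → α x ≡ true → α y ≡ false →
  (∀ z → β z ≡ α z xor pairSet x y z) → size β ≡ size α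
size-flip-crossing α β αx αy β≗ =
  +-cancelʳ-≡ 2 _ _ (trans (sym (cong (λ t → size β + 2 * t) (cong₂ _+_ (cong ind αx) (cong ind αy))))
                           (size-flip α β (≢-crossing α αx αy) β≗))

size-flip-preserved : ∀ {n} (α β : Fin n → Bool) {x y} → x ≢ y → (∀ z → β z ≡ α z xor pairSet x y z) →
  size β ≡ size α → α x ≡ true × α y ≡ false ⊎ α y ≡ true × α x ≡ false
size-flip-preserved α β {x} {y} x≢y β≗ same = cases (α x) (α y) refl refl
  (*-cancelˡ-≡ _ 1 2 (+-cancelˡ-≡ (size α) _ _ (trans (cong (_+ _) (sym same)) (size-flip α β x≢y β≗))))
  where
  cases : ∀ a b → α x ≡ a → α y ≡ b → ind a + ind b ≡ 1 → α x ≡ true × α y ≡ false ⊎ α y ≡ true × α x ≡ false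
  cases true  false αx αy _ = inj₁ (αx , αy)
  cases false true  αx αy _ = inj₂ (αy , αx)
  cases true  true  _  _  ()
  cases false false _  _  ()

-- Degrees in the token graph

card≡size : ∀ {n} (A : Subset n) → ∣ A ∣ ≡ size (lookup A)
card≡size []          = refl
card≡size (true ∷ A)  = cong suc (card≡size A)
card≡size (false ∷ A) = card≡size A

lookup-⁅⁆ : ∀ {n} (x z : Fin n) → lookup ⁅ x ⁆ z ≡ (z == x)
lookup-⁅⁆ zero    zero    = refl
lookup-⁅⁆ zero    (suc z) = lookup-replicate z false
lookup-⁅⁆ (suc x) zero    = refl
lookup-⁅⁆ (suc x) (suc z) with z ≟ x | lookup-⁅⁆ x z
... | yes _ | eq = eq
... | no _  | eq = eq

lookup-pair : ∀ {n} (x y z : Fin n) → lookup (⁅ x ⁆ ∪ ⁅ y ⁆) z ≡ pairSet x y z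
lookup-pair x y z = trans (lookup-zipWith _∨_ z ⁅ x ⁆ ⁅ y ⁆) (cong₂ _∨_ (lookup-⁅⁆ x z) (lookup-⁅⁆ y z))

==ˢ⇒≡ : ∀ {n} (S T : Subset n) → (S ==ˢ T) ≡ true → S ≡ T
==ˢ⇒≡ []      []      _ = refl
==ˢ⇒≡ (s ∷ S) (t ∷ T) h with s ≟ᵇ t
... | yes refl = cong (s ∷_) (==ˢ⇒≡ S T h)

Flips : ∀ {n} → Subset n → Subset n → Fin n → Fin n → Bool
Flips A B x y = (A △ B) ==ˢ (⁅ x ⁆ ∪ ⁅ y ⁆)

flips-lookup : ∀ {n} (A B : Subset n) {x y} → Flips A B x y ≡ true →
  ∀ z → lookup B z ≡ lookup A z xor pairSet x y z
flips-lookup A B {x} {y} h z = solve (lookup A z) (lookup B z) (begin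
  lookup A z xor lookup B z ≡⟨ sym (lookup-zipWith _xor_ z A B) ⟩
  lookup (A △ B) z          ≡⟨ cong (λ S → lookup S z) (==ˢ⇒≡ (A △ B) _ h) ⟩
  lookup (⁅ x ⁆ ∪ ⁅ y ⁆) z  ≡⟨ lookup-pair x y z ⟩
  pairSet x y z             ∎)
  where
  open ≡-Reasoning
  solve : ∀ a b {s} → a xor b ≡ s → b ≡ a xor s
  solve true  true  refl = refl
  solve true  false refl = refl
  solve false b     refl = refl

flips-sym : ∀ {n} (A B : Subset n) x y → Flips A B x y ≡ Flips A B y x
flips-sym A B x y = cong ((A △ B) ==ˢ_) (∪-comm ⁅ x ⁆ ⁅ y ⁆)
  where
  ∪-comm : ∀ {n} (S T : Subset n) → S ∪ T ≡ T ∪ S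
  ∪-comm []      []      = refl
  ∪-comm (s ∷ S) (t ∷ T) = cong₂ _∷_ (∨-comm s t) (∪-comm S T)

pairSet-∈ : ∀ {n} {x y z : Fin n} → pairSet x y z ≡ true → z ≡ x ⊎ z ≡ y
pairSet-∈ {x = x} {y} {z} h with z ≟ x | z ≟ y
... | yes z≡x | _       = inj₁ z≡x
... | no _    | yes z≡y = inj₂ z≡y

pairSet-left : ∀ {n} (x y : Fin n) → pairSet x y x ≡ true
pairSet-left x y rewrite ==-refl x = refl

pairSet-right : ∀ {n} (x y : Fin n) → pairSet x y y ≡ true
pairSet-right x y rewrite ==-refl y = ∨-zeroʳ (y == x)

flips-crossing-unique : ∀ {n} (A B : Subset n) {x y x′ y′} →
  lookup A x ≡ true → lookup A y ≡ false → lookup A x′ ≡ true → lookup A y′ ≡ false →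
  Flips A B x y ≡ true → Flips A B x′ y′ ≡ true → x ≡ x′ × y ≡ y′
flips-crossing-unique A B {x} {y} {x′} {y′} αx αy αx′ αy′ h h′ =
  first (pairSet-∈ (trans (sym (same x)) (pairSet-left x y))) ,
  second (pairSet-∈ (trans (sym (same y)) (pairSet-right x y)))
  where
  same : ∀ z → pairSet x y z ≡ pairSet x′ y′ z
  same z = begin
    pairSet x y z           ≡⟨ sym (lookup-pair x y z) ⟩
    lookup (⁅ x ⁆ ∪ ⁅ y ⁆) z    ≡⟨ cong (λ S → lookup S z) (sym (==ˢ⇒≡ (A △ B) _ h)) ⟩
    lookup (A △ B) z         ≡⟨ cong (λ S → lookup S z) (==ˢ⇒≡ (A △ B) _ h′) ⟩
    lookup (⁅ x′ ⁆ ∪ ⁅ y′ ⁆) z  ≡⟨ lookup-pair x′ y′ z ⟩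
    pairSet x′ y′ z          ∎
    where open ≡-Reasoning
  first : x ≡ x′ ⊎ x ≡ y′ → x ≡ x′
  first (inj₁ x≡x′) = x≡x′
  first (inj₂ refl) = contradiction (trans (sym αx) αy′) λ ()
  second : y ≡ x′ ⊎ y ≡ y′ → y ≡ y′
  second (inj₁ refl) = contradiction (trans (sym αx′) αy) λ ()
  second (inj₂ y≡y′) = y≡y′

length-filterᵇ : ∀ {X : Set} (p : X → Bool) xs → length (filterᵇ p xs) ≡ sumˡ (map (ind ∘ p) xs)
length-filterᵇ p []       = refl
length-filterᵇ p (x ∷ xs) with p x
... | true  = cong suc (length-filterᵇ p xs)
... | false = length-filterᵇ p xs

sumˡ-zeros : ∀ {X : Set} (xs : List X) → sumˡ (map (λ _ → 0) xs) ≡ 0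
sumˡ-zeros []       = refl
sumˡ-zeros (_ ∷ xs) = sumˡ-zeros xs

sumˡ-cut : ∀ {X : Set} {n} (W : X → Weight n) α xs →
  sumˡ (map (λ B → cut (W B) α) xs) ≡ cut (λ x y → sumˡ (map (λ B → W B x y) xs)) α
sumˡ-cut W α []       = sym (cut-zero α)
sumˡ-cut W α (B ∷ xs) = trans (cong (cut (W B) α +_) (sumˡ-cut W α xs)) (cut-+ (W B) _ α)

sumˡ-allSubsets : ∀ {n} (g : Subset (suc n) → ℕ) →
  sumˡ (map g (allSubsets (suc n))) ≡ sumˡ (map (g ∘ (false ∷_)) (allSubsets n)) + sumˡ (map (g ∘ (true ∷_)) (allSubsets n))
sumˡ-allSubsets {n} g = begin
  sumˡ (map g (map (false ∷_) Bs ++ map (true ∷_) Bs))       ≡⟨ cong sumˡ (map-++ g (map (false ∷_) Bs) _) ⟩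
  sumˡ (map g (map (false ∷_) Bs) ++ map g (map (true ∷_) Bs)) ≡⟨ sum-++ (map g (map (false ∷_) Bs)) _ ⟩
  _ ≡⟨ sym (cong₂ _+_ (cong sumˡ (map-∘ Bs)) (cong sumˡ (map-∘ Bs))) ⟩
  sumˡ (map (g ∘ (false ∷_)) Bs) + sumˡ (map (g ∘ (true ∷_)) Bs) ∎
  where
  open ≡-Reasoning
  Bs = allSubsets n

△-count : ∀ {n} (A S : Subset n) → sumˡ (map (λ B → ind ((A △ B) ==ˢ S)) (allSubsets n)) ≡ 1
△-count []      []      = refl
△-count {suc n} (a ∷ A) (s ∷ S) = trans (sumˡ-allSubsets {n} _) (split a s)
  where
  count = sumˡ (map (λ B → ind ((A △ B) ==ˢ S)) (allSubsets n))
  one = △-count A S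
  zero′ = sumˡ-zeros (allSubsets n)
  split : ∀ a s → sumˡ (map (λ B → ind (⌊ (a xor false) ≟ᵇ s ⌋ ∧ ((A △ B) ==ˢ S))) (allSubsets n))
                + sumˡ (map (λ B → ind (⌊ (a xor true) ≟ᵇ s ⌋ ∧ ((A △ B) ==ˢ S))) (allSubsets n)) ≡ 1
  split true  true  = trans (cong (count +_) zero′) (trans (+-identityʳ _) one)
  split true  false = trans (cong (_+ count) zero′) one
  split false true  = trans (cong (_+ count) zero′) one
  split false false = trans (cong (count +_) zero′) (trans (+-identityʳ _) one)

anyL-intro : ∀ {X : Set} (p : X → Bool) {xs x} → x ∈ xs → p x ≡ true → anyL p xs ≡ true
anyL-intro p {_ ∷ xs} (here refl) px = cong (_∨ anyL p xs) px
anyL-intro p {y ∷ _} (there x∈xs) px = trans (cong (p y ∨_) (anyL-intro p x∈xs px)) (∨-zeroʳ (p y))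

anyL-elim : ∀ {X : Set} (p : X → Bool) xs → anyL p xs ≡ true → ∃ λ x → p x ≡ true
anyL-elim p (x ∷ xs) h with p x in px
... | true  = x , px
... | false = anyL-elim p xs h

module _ {n} (G : Graph n) (A : Subset n) where

  private
    α = lookup A

  edgeFlip : Subset n → Fin n → Fin n → Bool
  edgeFlip B x y = adj G x y ∧ Flips A B x y

  tokenAdj-intro : ∀ B {x y} → adj G x y ≡ true → Flips A B x y ≡ true → tokenAdj G A B ≡ true
  tokenAdj-intro B {x} {y} xy f = anyL-intro _ (∈-allFin x) (anyL-intro _ (∈-allFin y) (trans (cong (_∧ Flips A B x y) xy) f))

  tokenAdj-elim : ∀ B → tokenAdj G A B ≡ true → ∃₂ λ x y → adj G x y ≡ true × Flips A B x y ≡ true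
  tokenAdj-elim B h with anyL-elim _ (allVertices n) h
  ... | x , hx with anyL-elim _ (allVertices n) hx
  ...   | y , hxy = x , y , ∧-true hxy

  cut-single-edgeFlip : ∀ B {x₀ y₀} → α x₀ ≡ true → α y₀ ≡ false →
    adj G x₀ y₀ ≡ true → Flips A B x₀ y₀ ≡ true → cut (weightOf (edgeFlip B)) α ≡ 1
  cut-single-edgeFlip B {x₀} {y₀} αx₀ αy₀ edge flip₀ = begin
    cut (weightOf (edgeFlip B)) α                    ≡⟨ cut-cong-crossing α only-x₀y₀ ⟩
    cut (λ x y → ind (x == x₀) * ind (y == y₀)) α    ≡⟨ cut-product (λ x → ind (x == x₀)) (λ y → ind (y == y₀)) α ⟩
    _ ≡⟨ cong₂ _*_ (trans (∑-ind-δ α x₀) (cong ind αx₀)) (trans (∑-ind-δ (not ∘ α) y₀) (cong (ind ∘ not) αy₀)) ⟩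
    1                                                ∎
    where
    open ≡-Reasoning
    only-x₀y₀ : ∀ x y → α x ≡ true → α y ≡ false → ind (edgeFlip B x y) ≡ ind (x == x₀) * ind (y == y₀)
    only-x₀y₀ x y αx αy with Flips A B x y in f
    ... | true with flips-crossing-unique A B αx αy αx₀ αy₀ f flip₀
    ...   | refl , refl rewrite edge | ==-refl x | ==-refl y = refl
    only-x₀y₀ x y αx αy | false rewrite ∧-zeroʳ (adj G x y) with x ≟ x₀ | y ≟ y₀
    ... | yes refl | yes refl = contradiction (trans (sym f) flip₀) λ ()
    ... | yes _    | no _     = refl
    ... | no _     | _        = refl

  -- Every neighbour B of A in F_k(G) is A △ {x, y} for exactly one edge xy leaving A.
  neighbour≡cut : ∀ {k} → ∣ A ∣ ≡ k → ∀ B →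
    ind (⌊ ∣ B ∣ ≟ⁿ k ⌋ ∧ tokenAdj G A B) ≡ cut (weightOf (edgeFlip B)) α
  neighbour≡cut {k} ∣A∣≡k B with ⌊ ∣ B ∣ ≟ⁿ k ⌋ ∧ tokenAdj G A B in nb
  ... | true with ∧-true nb
  ...   | ∣B∣≡k , adjacent with tokenAdj-elim B adjacent
  ...     | x , y , edge , flip with size-flip-preserved α (lookup B) x≢y (flips-lookup A B flip) same-size
    where
    x≢y : x ≢ y
    x≢y refl = contradiction (trans (sym edge) (Graph.irefl G x)) λ ()
    same-size : size (lookup B) ≡ size α
    same-size = begin
      size (lookup B) ≡⟨ sym (card≡size B) ⟩
      ∣ B ∣           ≡⟨ ⌊⌋-sound (∣ B ∣ ≟ⁿ k) ∣B∣≡k ⟩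
      k               ≡⟨ sym ∣A∣≡k ⟩
      ∣ A ∣           ≡⟨ card≡size A ⟩
      size α          ∎
      where open ≡-Reasoning
  ... | inj₁ (αx , αy) = sym (cut-single-edgeFlip B αx αy edge flip)
  ... | inj₂ (αy , αx) = sym (cut-single-edgeFlip B αy αx (trans (Graph.sym G y x) edge) (trans (flips-sym A B y x) flip))
  neighbour≡cut {k} ∣A∣≡k B | false = sym (trans (cut-cong-crossing α no-edgeFlip) (cut-zero α))
    where
    no-edgeFlip : ∀ x y → α x ≡ true → α y ≡ false → ind (edgeFlip B x y) ≡ 0
    no-edgeFlip x y αx αy with edgeFlip B x y in ef
    ... | false = refl
    ... | true  = contradiction (trans (sym nb) (cong₂ _∧_ (⌊⌋-true (∣ B ∣ ≟ⁿ k) ∣B∣≡k) (tokenAdj-intro B edge flip))) λ ()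
      where
      edge = proj₁ (∧-true ef)
      flip = proj₂ (∧-true ef)
      ∣B∣≡k : ∣ B ∣ ≡ k
      ∣B∣≡k = begin
        ∣ B ∣           ≡⟨ card≡size B ⟩
        size (lookup B) ≡⟨ size-flip-crossing α (lookup B) αx αy (flips-lookup A B flip) ⟩
        size α          ≡⟨ sym (card≡size A) ⟩
        ∣ A ∣           ≡⟨ ∣A∣≡k ⟩
        k               ∎
        where open ≡-Reasoning

tokenDegree≡cut : ∀ {n} (G : Graph n) k (A : Subset n) → ∣ A ∣ ≡ k → tokenDegree G k A ≡ cut (weightOf (adj G)) (lookup A)
tokenDegree≡cut {n} G k A ∣A∣≡k = begin
  tokenDegree G k A
    ≡⟨ length-filterᵇ _ Bs ⟩
  sumˡ (map (λ B → ind (⌊ ∣ B ∣ ≟ⁿ k ⌋ ∧ tokenAdj G A B)) Bs)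
    ≡⟨ cong sumˡ (map-cong (neighbour≡cut G A ∣A∣≡k) Bs) ⟩
  sumˡ (map (λ B → cut (weightOf (edgeFlip G A B)) α) Bs)
    ≡⟨ sumˡ-cut (λ B → weightOf (edgeFlip G A B)) α Bs ⟩
  cut (λ x y → sumˡ (map (λ B → ind (edgeFlip G A B x y)) Bs)) α
    ≡⟨ cut-cong-weight α flips-total ⟩
  cut (weightOf (adj G)) α ∎
  where
  open ≡-Reasoning
  Bs = allSubsets n
  α = lookup A
  flips-total : ∀ x y → sumˡ (map (λ B → ind (adj G x y ∧ Flips A B x y)) Bs) ≡ ind (adj G x y)
  flips-total x y with adj G x y
  ... | true  = △-count A (⁅ x ⁆ ∪ ⁅ y ⁆)
  ... | false = sumˡ-zeros Bs

-- Sets of prescribed size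

size-∨ : ∀ {n} (α β : Fin n → Bool) → size (λ x → α x ∨ β x) ≤ size α + size β
size-∨ {zero}  α β = z≤n
size-∨ {suc n} α β = ≤-trans (+-mono-≤ (pointwise (α zero) (β zero)) (size-∨ (α ∘ suc) (β ∘ suc)))
                             (≤-reflexive (+-assoc-swap (ind (α zero)) (ind (β zero)) _ _))
  where
  pointwise : ∀ a b → ind (a ∨ b) ≤ ind a + ind b
  pointwise true  _ = s≤s z≤n
  pointwise false _ = ≤-refl
  +-assoc-swap : ∀ a b c d → a + b + (c + d) ≡ a + c + (b + d)
  +-assoc-swap = solve-∀

size-any-== : ∀ {n} (ps : List (Fin n)) → size (λ x → any (x ==_) ps) ≤ length ps
size-any-== {n} []       = ≤-reflexive (sum-replicate-zero n)
size-any-== {n} (p ∷ ps) = ≤-trans (size-∨ (_== p) (λ x → any (x ==_) ps)) (+-mono-≤ (≤-reflexive (size-δ p)) (size-any-== ps))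

any-== : ∀ {n} {p : Fin n} {ps} → p ∈ ps → any (p ==_) ps ≡ true
any-== {p = p} {_ ∷ ps} (here refl) = cong (_∨ any (p ==_) ps) (==-refl p)
any-== {p = p} {q ∷ _} (there p∈ps) = trans (cong ((p == q) ∨_) (any-== p∈ps)) (∨-zeroʳ _)

subset-of-size : ∀ {n} (β : Fin n → Bool) m → m ≤ size β →
  ∃ λ α → size α ≡ m × (∀ x → β x ≡ false → α x ≡ false)
subset-of-size {zero}  β zero    _ = β , refl , λ ()
subset-of-size {suc n} β zero    _ = (λ _ → false) , sum-replicate-zero (suc n) , λ _ _ → refl
subset-of-size {suc n} β (suc m) m<β with β zero in β₀
... | true with subset-of-size (β ∘ suc) m (s≤s⁻¹ m<β)
...   | α , ∣α∣ , α⊆β = (λ { zero → true ; (suc x) → α x }) , cong suc ∣α∣ ,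
                        λ { zero β₀′ → contradiction (trans (sym β₀) β₀′) λ () ; (suc x) → α⊆β x }
subset-of-size {suc n} β (suc m) m<β | false with subset-of-size (β ∘ suc) (suc m) m<β
...   | α , ∣α∣ , α⊆β = (λ { zero → false ; (suc x) → α x }) , ∣α∣ , λ { zero _ → refl ; (suc x) → α⊆β x }

avoiding : ∀ {n} (ps : List (Fin n)) m → m + length ps ≤ n →
  ∃ λ α → size α ≡ m × (∀ {p} → p ∈ ps → α p ≡ false)
avoiding {n} ps m room with subset-of-size (not ∘ γ) m m≤free
  where
  γ = λ x → any (x ==_) ps
  m≤free : m ≤ size (not ∘ γ)
  m≤free = +-cancelʳ-≤ (size γ) m _ (begin
    m + size γ              ≤⟨ +-monoʳ-≤ m (size-any-== ps) ⟩
    m + length ps           ≤⟨ room ⟩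
    n                       ≡⟨ sym (size-compl γ) ⟩
    size (not ∘ γ) + size γ ∎)
    where open ≤-Reasoning
... | α , ∣α∣ , α⊆free = α , ∣α∣ , λ p∈ps → α⊆free _ (cong not (any-== p∈ps))

-- The four-point condition

CutRegular : ∀ {n} → Weight n → ℕ → Set
CutRegular {n} w k = ∃[ d ] ∀ (α : Fin n → Bool) → size α ≡ k → cut w α ≡ d

FourPoint : ∀ {n} → Weight n → Set
FourPoint w = ∀ {p q r s} → p ≢ r → q ≢ s → p ≢ s → q ≢ r → w p r + w q s ≡ w p s + w q r

module _ {n} (w : Weight n) (w-sym : ∀ x y → w x y ≡ w y x) (w-irrefl : ∀ x → w x x ≡ 0) where

  cut-insert-pair : ∀ (τ : Fin n → Bool) {p q} → p ≢ q → τ p ≡ false → τ q ≡ false →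
    cut w (insert (insert τ p) q) + 2 * degreeIn w τ p + 2 * degreeIn w τ q + 2 * w p q
      ≡ cut w τ + degree w p + degree w q
  cut-insert-pair τ {p} {q} p≢q τp τq = begin
    c″ + 2 * eₚ + 2 * e_q + 2 * w p q        ≡⟨ cong (λ t → c″ + 2 * eₚ + 2 * e_q + 2 * t) (w-sym p q) ⟩
    c″ + 2 * eₚ + 2 * e_q + 2 * w q p        ≡⟨ regroup c″ eₚ e_q (w q p) ⟩
    c″ + 2 * (e_q + w q p) + 2 * eₚ          ≡⟨ cong (λ t → c″ + 2 * t + 2 * eₚ) (sym (∑-insert τ p τp (w q))) ⟩
    c″ + 2 * degreeIn w τ′ q + 2 * eₚ        ≡⟨ cong (_+ 2 * eₚ) (cut-insert w w-sym w-irrefl τ′ q τ′q) ⟩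
    c′ + degree w q + 2 * eₚ                 ≡⟨ swap c′ (degree w q) (2 * eₚ) ⟩
    c′ + 2 * eₚ + degree w q                 ≡⟨ cong (_+ degree w q) (cut-insert w w-sym w-irrefl τ p τp) ⟩
    cut w τ + degree w p + degree w q        ∎
    where
    open ≡-Reasoning
    τ′ = insert τ p
    τ′q : τ′ q ≡ false
    τ′q = trans (insert-≢ τ (p≢q ∘ sym)) τq
    c′ = cut w τ′
    c″ = cut w (insert τ′ q)
    eₚ = degreeIn w τ p
    e_q = degreeIn w τ q
    regroup : ∀ c a b x → c + 2 * a + 2 * b + 2 * x ≡ c + 2 * (b + x) + 2 * a
    regroup = solve-∀
    swap : ∀ a b c → a + b + c ≡ a + c + b
    swap = solve-∀

  two-point-equation : ∀ {k d} → (∀ α → size α ≡ 2 + k → cut w α ≡ d) → ∀ (τ : Fin n → Bool) → size τ ≡ k →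
    ∀ {u v} → u ≢ v → τ u ≡ false → τ v ≡ false →
    d + 2 * degreeIn w τ u + 2 * degreeIn w τ v + 2 * w u v ≡ cut w τ + degree w u + degree w v
  two-point-equation {k} {d} regular τ ∣τ∣ {u} {v} u≢v τu τv =
    trans (cong (λ t → t + 2 * degreeIn w τ u + 2 * degreeIn w τ v + 2 * w u v) (sym (regular _ size-τ″)))
          (cut-insert-pair τ u≢v τu τv)
    where
    τ′v : insert τ u v ≡ false
    τ′v = trans (insert-≢ τ (u≢v ∘ sym)) τv
    size-τ″ : size (insert (insert τ u) v) ≡ 2 + k
    size-τ″ = trans (size-insert (insert τ u) v τ′v) (cong suc (trans (size-insert τ u τu) (cong suc ∣τ∣)))

-- The two-point equations for pr and qs add up to the same right-hand side as those for ps and qr.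
four-point-arith : ∀ d c eₚ e_q eᵣ eₛ Dₚ D_q Dᵣ Dₛ x y x′ y′ →
  d + 2 * eₚ + 2 * eᵣ + 2 * x ≡ c + Dₚ + Dᵣ →
  d + 2 * e_q + 2 * eₛ + 2 * y ≡ c + D_q + Dₛ →
  d + 2 * eₚ + 2 * eₛ + 2 * x′ ≡ c + Dₚ + Dₛ →
  d + 2 * e_q + 2 * eᵣ + 2 * y′ ≡ c + D_q + Dᵣ →
  x + y ≡ x′ + y′
four-point-arith d c eₚ e_q eᵣ eₛ Dₚ D_q Dᵣ Dₛ x y x′ y′ h₁ h₂ h₃ h₄ =
  *-cancelˡ-≡ _ _ 2 (+-cancelʳ-≡ K _ _ (begin
    2 * (x + y) + K                                                       ≡⟨ regroup d eₚ e_q eᵣ eₛ x y ⟩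
    (d + 2 * eₚ + 2 * eᵣ + 2 * x) + (d + 2 * e_q + 2 * eₛ + 2 * y)       ≡⟨ cong₂ _+_ h₁ h₂ ⟩
    (c + Dₚ + Dᵣ) + (c + D_q + Dₛ)                                        ≡⟨ exchange c Dₚ D_q Dᵣ Dₛ ⟩
    (c + Dₚ + Dₛ) + (c + D_q + Dᵣ)                                        ≡⟨ sym (cong₂ _+_ h₃ h₄) ⟩
    (d + 2 * eₚ + 2 * eₛ + 2 * x′) + (d + 2 * e_q + 2 * eᵣ + 2 * y′)     ≡⟨ sym (regroup′ d eₚ e_q eᵣ eₛ x′ y′) ⟩
    2 * (x′ + y′) + K                                                     ∎))
  where
  open ≡-Reasoning
  K = d + d + 2 * eₚ + 2 * e_q + 2 * eᵣ + 2 * eₛ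
  regroup : ∀ d a b r s x y → 2 * (x + y) + (d + d + 2 * a + 2 * b + 2 * r + 2 * s)
                                ≡ (d + 2 * a + 2 * r + 2 * x) + (d + 2 * b + 2 * s + 2 * y)
  regroup = solve-∀
  regroup′ : ∀ d a b r s x y → 2 * (x + y) + (d + d + 2 * a + 2 * b + 2 * r + 2 * s)
                                 ≡ (d + 2 * a + 2 * s + 2 * x) + (d + 2 * b + 2 * r + 2 * y)
  regroup′ = solve-∀
  exchange : ∀ c a b r s → (c + a + r) + (c + b + s) ≡ (c + a + s) + (c + b + r)
  exchange = solve-∀

regular⇒fourPoint : ∀ {n} (w : Weight n) → (∀ x y → w x y ≡ w y x) → (∀ x → w x x ≡ 0) →
  ∀ {k} → CutRegular w (2 + k) → k + 4 ≤ n → FourPoint w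
regular⇒fourPoint w w-sym w-irrefl {k} (d , regular) room {p} {q} {r} {s} p≢r q≢s p≢s q≢r
  with avoiding (p ∷ q ∷ r ∷ s ∷ []) k room
... | τ , ∣τ∣ , τ∌ =
  four-point-arith d (cut w τ) (e p) (e q) (e r) (e s) (D p) (D q) (D r) (D s) (w p r) (w q s) (w p s) (w q r)
    (equation p≢r τp τr) (equation q≢s τq τs) (equation p≢s τp τs) (equation q≢r τq τr)
  where
  e = degreeIn w τ
  D = degree w
  equation = two-point-equation w w-sym w-irrefl regular τ ∣τ∣
  τp = τ∌ (here refl)
  τq = τ∌ (there (here refl))
  τr = τ∌ (there (there (here refl)))
  τs = τ∌ (there (there (there (here refl))))

-- Graphs satisfying the four-point condition

IsComplete IsEdgeless : ∀ {n} → (Fin n → Fin n → Bool) → Set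
IsComplete a = ∀ x y → a x y ≡ not (x == y)
IsEdgeless a = ∀ x y → a x y ≡ false

IsStarAt IsCostarAt : ∀ {n} → Fin n → (Fin n → Fin n → Bool) → Set
IsStarAt   c a = ∀ x y → a x y ≡ starAdj c x y
IsCostarAt c a = ∀ x y → a x y ≡ not (x == y) ∧ not (starAdj c x y)

module Classification {n} (a : Fin n → Fin n → Bool)
  (a-sym : ∀ x y → a x y ≡ a y x) (a-irrefl : ∀ x → a x x ≡ false) (fp : FourPoint (weightOf a)) where

  fourPoint : ∀ {p q r s b₁ b₂ b₃ b₄} → p ≢ r → q ≢ s → p ≢ s → q ≢ r →
    a p r ≡ b₁ → a q s ≡ b₂ → a p s ≡ b₃ → a q r ≡ b₄ → ind b₁ + ind b₂ ≡ ind b₃ + ind b₄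
  fourPoint p≢r q≢s p≢s q≢r refl refl refl refl = fp p≢r q≢s p≢s q≢r

  Split : Set
  Split = ∃ λ u → ∃ λ v → ∃ λ w → u ≢ w × v ≢ w × a u w ≡ true × a v w ≡ false

  module FromSplit {u v w} (u≢w : u ≢ w) (v≢w : v ≢ w) (uw : a u w ≡ true) (vw : a v w ≡ false) where

    u≢v : u ≢ v
    u≢v refl = contradiction (trans (sym uw) vw) λ ()

    -- The four-point condition on u, v, w, z reads 1 + [vz] = [uz] + 0.
    separated : ∀ z → z ≢ u → z ≢ v → a u z ≡ true × a v z ≡ false
    separated z z≢u z≢v with a u z in uz | a v z in vz
    ... | true  | false = refl , refl
    ... | true  | true  = contradiction (fourPoint u≢w (z≢v ∘ sym) (z≢u ∘ sym) v≢w uw vz uz vw) λ ()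
    ... | false | _     = contradiction (fourPoint u≢w (z≢v ∘ sym) (z≢u ∘ sym) v≢w uw vz uz vw) λ ()

    u-sees : ∀ {z} → z ≢ u → z ≢ v → a z u ≡ true
    u-sees {z} z≢u z≢v = trans (a-sym z u) (proj₁ (separated z z≢u z≢v))

    v-misses : ∀ {z} → z ≢ u → z ≢ v → a v z ≡ false
    v-misses {z} z≢u z≢v = proj₂ (separated z z≢u z≢v)

    module _ (uv : a u v ≡ true) where

      u-adjacent : ∀ y → y ≢ u → a u y ≡ true
      u-adjacent y y≢u with y ≟ v
      ... | yes refl = uv
      ... | no y≢v   = proj₁ (separated y y≢u y≢v)

      v-leaf : ∀ y → y ≢ u → a v y ≡ false
      v-leaf y y≢u with y ≟ v
      ... | yes refl = a-irrefl v
      ... | no y≢v   = v-misses y≢u y≢v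

      leaves-independent : ∀ x y → x ≢ u → y ≢ u → a x y ≡ false
      leaves-independent x y x≢u y≢u with x ≟ v | y ≟ v
      ... | yes refl | _        = v-leaf y y≢u
      ... | no _     | yes refl = trans (a-sym x v) (v-leaf x x≢u)
      ... | no x≢v   | no y≢v with x ≟ y
      ...   | yes refl = a-irrefl x
      ...   | no x≢y with a x y in xy
      ...     | false = refl
      ...     | true  = contradiction (fourPoint x≢u (y≢v ∘ sym) x≢y (u≢v ∘ sym)
                          (u-sees x≢u x≢v) (v-misses y≢u y≢v) xy (trans (a-sym v u) uv)) λ ()

      star-at-u : IsStarAt u a
      star-at-u x y with x ≟ u | y ≟ u
      ... | yes refl | yes refl = a-irrefl u
      ... | yes refl | no y≢u   = u-adjacent y y≢u
      ... | no x≢u   | yes refl = trans (a-sym x u) (u-adjacent x x≢u)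
      ... | no x≢u   | no y≢u   = leaves-independent x y x≢u y≢u

    module _ (uv : a u v ≡ false) where

      v-isolated : ∀ y → a v y ≡ false
      v-isolated y with y ≟ u | y ≟ v
      ... | yes refl | _        = trans (a-sym v u) uv
      ... | no _     | yes refl = a-irrefl v
      ... | no y≢u   | no y≢v   = v-misses y≢u y≢v

      others-adjacent : ∀ x y → x ≢ v → y ≢ v → x ≢ y → a x y ≡ true
      others-adjacent x y x≢v y≢v x≢y with x ≟ u | y ≟ u
      ... | yes refl | _        = proj₁ (separated y (x≢y ∘ sym) y≢v)
      ... | no _     | yes refl = u-sees x≢y x≢v
      ... | no x≢u   | no y≢u with a x y in xy
      ...   | true  = refl
      ...   | false = contradiction (fourPoint x≢y (u≢v ∘ sym) x≢u (y≢v ∘ sym)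
                        xy (trans (a-sym v u) uv) (u-sees x≢u x≢v) (v-misses y≢u y≢v)) λ ()

      costar-at-v : IsCostarAt v a
      costar-at-v x y with x ≟ v | y ≟ v
      ... | yes refl | yes refl rewrite ==-refl v = a-irrefl v
      ... | yes refl | no _     = trans (v-isolated y) (sym (∧-zeroʳ _))
      ... | no _     | yes refl = trans (a-sym x v) (trans (v-isolated x) (sym (∧-zeroʳ _)))
      ... | no x≢v   | no y≢v with x ≟ y
      ...   | yes refl = a-irrefl x
      ...   | no x≢y   = others-adjacent x y x≢v y≢v x≢y

    star-or-costar : (∃ λ c → IsStarAt c a) ⊎ (∃ λ c → IsCostarAt c a)
    star-or-costar with a u v in uv
    ... | true  = inj₁ (u , star-at-u uv)
    ... | false = inj₂ (v , costar-at-v uv)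

  module _ (no-split : ¬ Split) where

    uniform : ∀ {u v w} → u ≢ w → v ≢ w → a u w ≡ true → a v w ≡ true
    uniform {u} {v} {w} u≢w v≢w uw with a v w in vw
    ... | true  = refl
    ... | false = contradiction (u , v , w , u≢w , v≢w , uw , vw) no-split

    adj⇒≢ : ∀ {x y} → a x y ≡ true → x ≢ y
    adj⇒≢ {x} xy refl = contradiction (trans (sym xy) (a-irrefl x)) λ ()

    complete-or-edgeless : IsComplete a ⊎ IsEdgeless a
    complete-or-edgeless with any? (λ x → any? (λ y → a x y ≟ᵇ true))
    ... | yes (x , y , xy) = inj₁ all-adjacent
      where
      adjacent : ∀ p q → p ≢ q → a p q ≡ true
      adjacent p q p≢q with q ≟ y
      ... | yes refl = uniform (adj⇒≢ xy) p≢q xy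
      ... | no q≢y   = uniform (q≢y ∘ sym) p≢q (trans (a-sym y q) (uniform (adj⇒≢ xy) q≢y xy))
      all-adjacent : IsComplete a
      all-adjacent p q with p ≟ q
      ... | yes refl = a-irrefl p
      ... | no p≢q   = adjacent p q p≢q
    ... | no no-edge = inj₂ none-adjacent
      where
      none-adjacent : IsEdgeless a
      none-adjacent p q with a p q in pq
      ... | false = refl
      ... | true  = contradiction (p , q , pq) no-edge

  classify : IsComplete a ⊎ IsEdgeless a ⊎ (∃ λ c → IsStarAt c a) ⊎ (∃ λ c → IsCostarAt c a)
  classify with split?
    where
    split? = any? λ u → any? λ v → any? λ w →
      ¬? (u ≟ w) ×-dec ¬? (v ≟ w) ×-dec (a u w ≟ᵇ true) ×-dec (a v w ≟ᵇ false)
  ... | yes (u , v , w , u≢w , v≢w , uw , vw) = inj₂ (inj₂ (FromSplit.star-or-costar u≢w v≢w uw vw))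
  ... | no no-split with complete-or-edgeless no-split
  ...   | inj₁ isComplete = inj₁ isComplete
  ...   | inj₂ isEdgeless = inj₂ (inj₁ isEdgeless)

-- Recognising the four families up to isomorphism

==-injective : ∀ {n} (f : Fin n → Fin n) → (∀ {x y} → f x ≡ f y → x ≡ y) → ∀ x y → (f x == f y) ≡ (x == y)
==-injective f f-inj x y with x ≟ y
... | yes refl = ==-refl (f x)
... | no x≢y   = ==-≢ (x≢y ∘ f-inj)

adj-star : ∀ m (i j : Fin (suc m)) → adj (star m) i j ≡ starAdj zero i j
adj-star m zero    zero    = refl
adj-star m zero    (suc j) = refl
adj-star m (suc i) zero    = refl
adj-star m (suc i) (suc j) = refl

not-∧-not-not : ∀ b → not b ∧ not (not b) ≡ false
not-∧-not-not true  = refl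
not-∧-not-not false = refl

module Relabel {n} (σ : Fin n ↔ Fin n) where

  open Inverse σ using (to; from; strictlyInverseˡ; strictlyInverseʳ)

  from-injective : ∀ {x y} → from x ≡ from y → x ≡ y
  from-injective {x} {y} eq = trans (sym (strictlyInverseˡ x)) (trans (cong to eq) (strictlyInverseˡ y))

  to-injective : ∀ {x y} → to x ≡ to y → x ≡ y
  to-injective {x} {y} eq = trans (sym (strictlyInverseʳ x)) (trans (cong from eq) (strictlyInverseʳ y))

  ==-from : ∀ x y → (from x == from y) ≡ (x == y)
  ==-from = ==-injective from from-injective

  ==-to : ∀ x y → (to x == to y) ≡ (x == y)
  ==-to = ==-injective to to-injective

  ==-from-to : ∀ x z → (from x == z) ≡ (x == to z)
  ==-from-to x z = trans (cong (from x ==_) (sym (strictlyInverseʳ z))) (==-from x (to z))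

  starAdj-from : ∀ c x y → starAdj c (from x) (from y) ≡ starAdj (to c) x y
  starAdj-from c x y = cong₂ _xor_ (==-from-to x c) (==-from-to y c)

  starAdj-to : ∀ c x y → starAdj (to c) (to x) (to y) ≡ starAdj c x y
  starAdj-to c x y = cong₂ _xor_ (==-to x c) (==-to y c)

adj-via-≅ : ∀ {n} {G H : Graph n} (iso : G ≅ H) → let from = Inverse.from (proj₁ iso) in
  ∀ x y → adj G x y ≡ adj H (from x) (from y)
adj-via-≅ {G = G} (σ , σ-preserves) x y =
  trans (cong₂ (adj G) (sym (strictlyInverseˡ x)) (sym (strictlyInverseˡ y))) (σ-preserves (from x) (from y))
  where open Inverse σ using (from; strictlyInverseˡ)

≅complete⇒isComplete : ∀ {n} (G : Graph n) → G ≅ complete n → IsComplete (adj G)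
≅complete⇒isComplete {n} G iso@(σ , _) x y =
  trans (adj-via-≅ {G = G} {complete n} iso x y) (cong not (Relabel.==-from σ x y))

≅edgeless⇒isEdgeless : ∀ {n} (G : Graph n) → G ≅ edgeless n → IsEdgeless (adj G)
≅edgeless⇒isEdgeless {n} G iso@(σ , _) x y =
  trans (adj-via-≅ {G = G} {edgeless n} iso x y) (not-∧-not-not (Inverse.from σ x == Inverse.from σ y))

≅star⇒isStarAt : ∀ {m} (G : Graph (suc m)) → (iso : G ≅ star m) → IsStarAt (Inverse.to (proj₁ iso) zero) (adj G)
≅star⇒isStarAt {m} G iso@(σ , _) x y =
  trans (adj-via-≅ {G = G} {star m} iso x y) (trans (adj-star m _ _) (Relabel.starAdj-from σ zero x y))

≅costar⇒isCostarAt : ∀ {m} (G : Graph (suc m)) → (iso : G ≅ complement (star m)) →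
  IsCostarAt (Inverse.to (proj₁ iso) zero) (adj G)
≅costar⇒isCostarAt {m} G iso@(σ , _) x y = trans (adj-via-≅ {G = G} {complement (star m)} iso x y)
  (cong₂ (λ e s → not e ∧ not s) (Relabel.==-from σ x y) (trans (adj-star m _ _) (Relabel.starAdj-from σ zero x y)))

isComplete⇒≅complete : ∀ {n} (G : Graph n) → IsComplete (adj G) → G ≅ complete n
isComplete⇒≅complete G complete = ↔-id _ , complete

isEdgeless⇒≅edgeless : ∀ {n} (G : Graph n) → IsEdgeless (adj G) → G ≅ edgeless n
isEdgeless⇒≅edgeless G edgeless = ↔-id _ , λ x y → trans (edgeless x y) (sym (not-∧-not-not (x == y)))

-- The transposition of 0 and c sends the centre 0 of star m to c (definitionally).
isStarAt⇒≅star : ∀ {m} (G : Graph (suc m)) c → IsStarAt c (adj G) → G ≅ star m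
isStarAt⇒≅star {m} G c starAt = σ , λ i j →
  trans (starAt _ _) (trans (Relabel.starAdj-to σ zero i j) (sym (adj-star m i j)))
  where σ = transpose zero c

isCostarAt⇒≅costar : ∀ {m} (G : Graph (suc m)) c → IsCostarAt c (adj G) → G ≅ complement (star m)
isCostarAt⇒≅costar {m} G c costarAt = σ , λ i j → trans (costarAt _ _)
  (cong₂ (λ e s → not e ∧ not s) (Relabel.==-to σ i j) (trans (Relabel.starAdj-to σ zero i j) (sym (adj-star m i j))))
  where σ = transpose zero c

-- Regularity of the four families

tokenRegular⇔cutRegular : ∀ {n} (G : Graph n) k → TokenRegular G k ⇔ CutRegular (weightOf (adj G)) k
tokenRegular⇔cutRegular {n} G k = mk⇔ to from
  where
  open ≡-Reasoning
  w = weightOf (adj G)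
  to : TokenRegular G k → CutRegular w k
  to (d , regular) = d , λ α ∣α∣ →
    let ∣A∣ = trans (card≡size (tabulate α)) (trans (sum-cong-≗ {n} (cong ind ∘ lookup∘tabulate α)) ∣α∣) in begin
      cut w α                       ≡⟨ cut-cong-set w (sym ∘ lookup∘tabulate α) ⟩
      cut w (lookup (tabulate α))   ≡⟨ sym (tokenDegree≡cut G k (tabulate α) ∣A∣) ⟩
      tokenDegree G k (tabulate α)  ≡⟨ regular (tabulate α) ∣A∣ ⟩
      d                             ∎
  from : CutRegular w k → TokenRegular G k
  from (d , regular) = d , λ A ∣A∣ →
    trans (tokenDegree≡cut G k A ∣A∣) (regular (lookup A) (trans (sym (card≡size A)) ∣A∣))

size-compl-≡ : ∀ {n k} (α : Fin n → Bool) → size α ≡ k → size (not ∘ α) ≡ n ∸ k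
size-compl-≡ {n} {k} α ∣α∣ = begin
  size (not ∘ α)                ≡⟨ sym (m+n∸n≡m _ k) ⟩
  size (not ∘ α) + k ∸ k        ≡⟨ cong (λ t → size (not ∘ α) + t ∸ k) (sym ∣α∣) ⟩
  size (not ∘ α) + size α ∸ k   ≡⟨ cong (_∸ k) (size-compl α) ⟩
  n ∸ k                         ∎
  where open ≡-Reasoning

module _ {n} (a : Fin n → Fin n → Bool) (k : ℕ) where

  isComplete⇒regular : IsComplete a → CutRegular (weightOf a) k
  isComplete⇒regular complete = k * (n ∸ k) , λ α ∣α∣ →
    trans (cut-cong-weight α (λ x y → cong ind (complete x y)))
          (trans (cut-complete α) (cong₂ _*_ ∣α∣ (size-compl-≡ α ∣α∣)))

  isEdgeless⇒regular : IsEdgeless a → CutRegular (weightOf a) k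
  isEdgeless⇒regular edgeless = 0 , λ α _ → trans (cut-cong-weight α (λ x y → cong ind (edgeless x y))) (cut-zero α)

  module _ (c : Fin n) (balanced : 2 * k ≡ n) where

    n∸k≡k : n ∸ k ≡ k
    n∸k≡k = trans (cong (_∸ k) (sym balanced)) (trans (cong (λ t → (k + t) ∸ k) (+-identityʳ k)) (m+n∸m≡n k k))

    cut-star-balanced : ∀ α → size α ≡ k → cut (weightOf (starAdj c)) α ≡ k
    cut-star-balanced α ∣α∣ with α c in αc
    ... | true  = trans (cut-star-∈ c α αc) (trans (size-compl-≡ α ∣α∣) n∸k≡k)
    ... | false = trans (cut-star-∉ c α αc) ∣α∣

    balanced-isStarAt⇒regular : IsStarAt c a → CutRegular (weightOf a) k
    balanced-isStarAt⇒regular starAt = k , λ α ∣α∣ →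
      trans (cut-cong-weight α (λ x y → cong ind (starAt x y))) (cut-star-balanced α ∣α∣)

    balanced-isCostarAt⇒regular : IsCostarAt c a → CutRegular (weightOf a) k
    balanced-isCostarAt⇒regular costarAt = k * k ∸ k , λ α ∣α∣ →
      trans (sym (m+n∸n≡m _ k)) (cong (_∸ k) (begin
        cut (weightOf a) α + k
          ≡⟨ cong₂ _+_ (cut-cong-weight α (λ x y → cong ind (costarAt x y))) (sym (cut-star-balanced α ∣α∣)) ⟩
        cut (weightOf λ x y → not (x == y) ∧ not (starAdj c x y)) α + cut (weightOf (starAdj c)) α
          ≡⟨ cut-complement (starAdj c) α ⟩
        size α * size (not ∘ α)
          ≡⟨ cong₂ _*_ ∣α∣ (trans (size-compl-≡ α ∣α∣) n∸k≡k) ⟩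
        k * k ∎))
      where open ≡-Reasoning

-- A k-set has star cut n - k or k according as it contains the centre, and both kinds exist.
star-cut-constant⇒balanced : ∀ {n k} (c : Fin n) → 1 ≤ k → k + 1 ≤ n →
  (∀ α β → size α ≡ k → size β ≡ k → cut (weightOf (starAdj c)) α ≡ cut (weightOf (starAdj c)) β) → 2 * k ≡ n
star-cut-constant⇒balanced {n} {suc k} c _ room constant
  with avoiding (c ∷ []) k (≤-trans (n≤1+n (k + 1)) room) | avoiding (c ∷ []) (suc k) room
... | α , ∣α∣ , α∌c | β , ∣β∣ , β∌c = begin
  2 * suc k             ≡⟨ cong (suc k +_) (+-identityʳ (suc k)) ⟩
  suc k + suc k         ≡⟨ cong (suc k +_) (sym complement-size) ⟩
  suc k + (n ∸ suc k)   ≡⟨ m+[n∸m]≡n (≤-trans (m≤m+n (suc k) 1) room) ⟩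
  n                     ∎
  where
  open ≡-Reasoning
  α′ = insert α c
  ∣α′∣ : size α′ ≡ suc k
  ∣α′∣ = trans (size-insert α c (α∌c (here refl))) (cong suc ∣α∣)
  complement-size : n ∸ suc k ≡ suc k
  complement-size = begin
    n ∸ suc k                      ≡⟨ sym (size-compl-≡ α′ ∣α′∣) ⟩
    size (not ∘ α′)                ≡⟨ sym (cut-star-∈ c α′ (insert-here α c)) ⟩
    cut (weightOf (starAdj c)) α′  ≡⟨ constant α′ β ∣α′∣ ∣β∣ ⟩
    cut (weightOf (starAdj c)) β   ≡⟨ cut-star-∉ c β (β∌c (here refl)) ⟩
    size β                         ≡⟨ ∣β∣ ⟩
    suc k                          ∎

module _ {n} (a : Fin n → Fin n → Bool) {k} (c : Fin n) (1≤k : 1 ≤ k) (room : k + 1 ≤ n) where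

  isStarAt-regular⇒balanced : IsStarAt c a → CutRegular (weightOf a) k → 2 * k ≡ n
  isStarAt-regular⇒balanced starAt (d , regular) = star-cut-constant⇒balanced c 1≤k room λ α β ∣α∣ ∣β∣ →
    trans (sym (as-star α)) (trans (regular α ∣α∣) (trans (sym (regular β ∣β∣)) (as-star β)))
    where
    as-star : ∀ α → cut (weightOf a) α ≡ cut (weightOf (starAdj c)) α
    as-star α = cut-cong-weight α (λ x y → cong ind (starAt x y))

  isCostarAt-regular⇒balanced : IsCostarAt c a → CutRegular (weightOf a) k → 2 * k ≡ n
  isCostarAt-regular⇒balanced costarAt (d , regular) = star-cut-constant⇒balanced c 1≤k room λ α β ∣α∣ ∣β∣ →
    +-cancelˡ-≡ d _ _ (trans (total α ∣α∣) (sym (total β ∣β∣)))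
    where
    total : ∀ α → size α ≡ k → d + cut (weightOf (starAdj c)) α ≡ k * (n ∸ k)
    total α ∣α∣ = begin
      d + cut (weightOf (starAdj c)) α
        ≡⟨ cong (_+ cut (weightOf (starAdj c)) α) (sym (regular α ∣α∣)) ⟩
      cut (weightOf a) α + cut (weightOf (starAdj c)) α
        ≡⟨ cong (_+ cut (weightOf (starAdj c)) α) (cut-cong-weight α (λ x y → cong ind (costarAt x y))) ⟩
      cut (weightOf λ x y → not (x == y) ∧ not (starAdj c x y)) α + cut (weightOf (starAdj c)) α
        ≡⟨ cut-complement (starAdj c) α ⟩
      size α * size (not ∘ α)
        ≡⟨ cong₂ _*_ ∣α∣ (size-compl-≡ α ∣α∣) ⟩
      k * (n ∸ k) ∎
      where open ≡-Reasoning

classified⇒family : ∀ {m k} (G : Graph (suc m)) → 1 ≤ k → k + 1 ≤ suc m → CutRegular (weightOf (adj G)) k →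
  IsComplete (adj G) ⊎ IsEdgeless (adj G) ⊎ (∃ λ c → IsStarAt c (adj G)) ⊎ (∃ λ c → IsCostarAt c (adj G)) →
  G ≅ complete (suc m) ⊎ G ≅ edgeless (suc m) ⊎ (G ≅ star m × 2 * k ≡ suc m) ⊎ (G ≅ complement (star m) × 2 * k ≡ suc m)
classified⇒family G 1≤k room regular (inj₁ complete) = inj₁ (isComplete⇒≅complete G complete)
classified⇒family G 1≤k room regular (inj₂ (inj₁ edgeless)) = inj₂ (inj₁ (isEdgeless⇒≅edgeless G edgeless))
classified⇒family G 1≤k room regular (inj₂ (inj₂ (inj₁ (c , starAt)))) =
  inj₂ (inj₂ (inj₁ (isStarAt⇒≅star G c starAt , isStarAt-regular⇒balanced (adj G) c 1≤k room starAt regular)))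
classified⇒family G 1≤k room regular (inj₂ (inj₂ (inj₂ (c , costarAt)))) =
  inj₂ (inj₂ (inj₂ (isCostarAt⇒≅costar G c costarAt , isCostarAt-regular⇒balanced (adj G) c 1≤k room costarAt regular)))

theorem1 : (n k : ℕ) (G : Graph n) → 2 ≤ k → k + 2 ≤ n →
    (TokenRegular G k ⇔
      (G ≅ complete n
       ⊎ G ≅ edgeless n
       ⊎ (G ≅ starGraph n × 2 * k ≡ n)
       ⊎ (G ≅ complement (starGraph n) × 2 * k ≡ n)))
theorem1 zero    (suc (suc _)) G (s≤s (s≤s z≤n)) ()
theorem1 (suc m) (suc (suc k)) G (s≤s (s≤s z≤n)) room = mk⇔
  (λ regular → classified⇒family G (s≤s z≤n) (≤-trans (+-monoʳ-≤ (2 + k) (s≤s z≤n)) room) (to regular)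
                 (Classification.classify a (Graph.sym G) (Graph.irefl G) (fourPoint regular)))
  λ { (inj₁ iso)                         → from (isComplete⇒regular a (2 + k) (≅complete⇒isComplete G iso))
    ; (inj₂ (inj₁ iso))                  → from (isEdgeless⇒regular a (2 + k) (≅edgeless⇒isEdgeless G iso))
    ; (inj₂ (inj₂ (inj₁ (iso , 2k≡n))))  → from (balanced-isStarAt⇒regular a (2 + k) _ 2k≡n (≅star⇒isStarAt G iso))
    ; (inj₂ (inj₂ (inj₂ (iso , 2k≡n))))  → from (balanced-isCostarAt⇒regular a (2 + k) _ 2k≡n (≅costar⇒isCostarAt G iso)) }
  where
  open Equivalence (tokenRegular⇔cutRegular G (2 + k))
  a = adj G
  fourPoint : TokenRegular G (2 + k) → FourPoint (weightOf a)
  fourPoint regular = regular⇒fourPoint (weightOf a) (λ x y → cong ind (Graph.sym G x y)) (λ x → cong ind (Graph.irefl G x))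
                        (to regular) (≤-trans (≤-reflexive (shift k)) room)
    where
    shift : ∀ k → k + 4 ≡ 2 + k + 2
    shift = solve-∀
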